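{- Let $a,b,a_0,b_0$ be integers with $a_0\le a<b\le b_0$, and let $$R(t)=\frac{(b-a-1)!}{(t+a)(t+a+1)\cdots(t+b-1)}.$$ Then for every integer $k$ with $a_0\le k<b_0$, every prime $p>\sqrt{b_0-a_0-1}$, and every non-negative integer $j$, $$\operatorname{ord}_p\frac{d^j}{dt^j}\bigl(R(t)(t+k)\bigr)\Big|_{t=-k}\ge -j+\Bigl\lfloor\frac{b-a-1}p\Bigr\rfloor-\Bigl\lfloor\frac{k-a}p\Bigr\rfloor-\Bigl\lfloor\frac{b-1-k}p\Bigr\rfloor.$$
   Context: $\operatorname{ord}_p$ is the $p$-adic valuation on $\mathbb Q$, with $\operatorname{ord}_p0=+\infty$; $\lfloor x\rfloor$ is the integer part of $x$. $R(t)(t+k)$ is regarded as a rational function of $t$ (after cancellation), regular at $t=-k$. -}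

module Defs where

open import Data.Nat as ℕ using (ℕ; zero; suc)
open import Data.Nat.Divisibility using (_∣?_; divides)
open import Data.Integer as ℤ using (ℤ; +_; -[1+_]; ∣_∣; _/ℕ_)
open import Data.Rational as ℚ using (ℚ; mkℚ; 0ℚ; 1/_; ≢-nonZero)
open import Data.Rational.Properties using () renaming (_≟_ to _≟ℚ_)
open import Data.List using (List; []; _∷_; foldr; downFrom; map)
open import Relation.Nullary using (yes; no)

-- Polynomials in one variable t with integer coefficients,
-- as coefficient lists (constant term first).

Poly : Set
Poly = List ℤ

infixl 6 _+ₚ_
infixl 7 _*ₚ_ _·ₚ_

_+ₚ_ : Poly → Poly → Poly
[]       +ₚ q        = q
(x ∷ p)  +ₚ []       = x ∷ p
(x ∷ p)  +ₚ (y ∷ q)  = (x ℤ.+ y) ∷ (p +ₚ q)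

_·ₚ_ : ℤ → Poly → Poly
c ·ₚ p = map (c ℤ.*_) p

_*ₚ_ : Poly → Poly → Poly
[]      *ₚ q = []
(x ∷ p) *ₚ q = (x ·ₚ q) +ₚ (ℤ.+ 0 ∷ (p *ₚ q))

negₚ : Poly → Poly
negₚ p = (ℤ.- ℤ.+ 1) ·ₚ p

constₚ : ℤ → Poly
constₚ c = c ∷ []

linₚ : ℤ → Poly
linₚ c = c ∷ ℤ.+ 1 ∷ []

derivAux : ℕ → Poly → Poly
derivAux i []      = []
derivAux i (x ∷ p) = (ℤ.+ i ℤ.* x) ∷ derivAux (suc i) p

derivₚ : Poly → Poly
derivₚ []      = []
derivₚ (x ∷ p) = derivAux 1 p

evalₚ : Poly → ℤ → ℤ
evalₚ p x = foldr (λ c acc → c ℤ.+ x ℤ.* acc) (ℤ.+ 0) p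

prodₚ : List Poly → Poly
prodₚ = foldr _*ₚ_ (constₚ (ℤ.+ 1))

record RatFun : Set where
  constructor _⁄_
  field
    num : Poly
    den : Poly
open RatFun public

derivRF : RatFun → RatFun
derivRF (P ⁄ Q) = ((derivₚ P *ₚ Q) +ₚ negₚ (P *ₚ derivₚ Q)) ⁄ (Q *ₚ Q)

derivRF^ : ℕ → RatFun → RatFun
derivRF^ zero    f = f
derivRF^ (suc j) f = derivRF (derivRF^ j f)

-- reciprocal in ℚ (with the junk value 1/0 = 0; only used at nonzero arguments)
recipℚ : ℚ → ℚ
recipℚ q with q ≟ℚ 0ℚ
... | yes _  = 0ℚ
... | no q≢0 = 1/_ q {{≢-nonZero q≢0}}

-- value of P/Q at the integer point x (meaningful when Q(x) ≠ 0)
evalRF : RatFun → ℤ → ℚ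
evalRF (P ⁄ Q) x = ℚ._*_ (ℚ._/_ (evalₚ P x) 1) (recipℚ (ℚ._/_ (evalₚ Q x) 1))

-- The rational function  R(t)(t+k)  after cancellation, where
--   R(t) = (b-a-1)! / ((t+a)(t+a+1)...(t+b-1)),   a < b.
-- Numerator: (b-a-1)! times (t+k) if k ∉ [a, b-1] (otherwise the factor
-- t+k cancels against the denominator); denominator: the product of
-- (t+i) over a ≤ i ≤ b-1, i ≠ k.

range : ℤ → ℕ → List ℤ
range a n = map (λ i → a ℤ.+ ℤ.+ i) (downFrom n)

denFactors : ℤ → ℤ → ℤ → List Poly
denFactors a b k =
  foldr (λ i acc → if≡ i acc) [] (range a ∣ b ℤ.- a ∣)
  where
  if≡ : ℤ → List Poly → List Poly
  if≡ i acc with i ℤ.≟ k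
  ... | yes _ = acc
  ... | no  _ = linₚ i ∷ acc

numRk : ℤ → ℤ → ℤ → Poly
numRk a b k with a ℤ.≤? k | k ℤ.<? b
... | yes _ | yes _ = constₚ (ℤ.+ ((∣ b ℤ.- a ∣ ℕ.∸ 1) ℕ.!))
... | _     | _     = (ℤ.+ ((∣ b ℤ.- a ∣ ℕ.∸ 1) ℕ.!)) ·ₚ linₚ k

RtimesLin : ℤ → ℤ → ℤ → RatFun
RtimesLin a b k = numRk a b k ⁄ prodₚ (denFactors a b k)

-- ord_p on positive naturals: exponent of p in n (fuel-bounded; the
-- fuel n suffices since p ≥ 2 and n ≥ 1 give ord_p n < n).
ordℕ-fuel : ℕ → ℕ → ℕ → ℕ
ordℕ-fuel zero     p n = 0
ordℕ-fuel (suc f)  p n with p ∣? n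
... | yes (divides q _) = suc (ordℕ-fuel f p q)
... | no  _             = 0

ordℕ : ℕ → ℕ → ℕ
ordℕ p n = ordℕ-fuel n p n

data ℤ∞ : Set where
  fin : ℤ → ℤ∞
  ∞   : ℤ∞

data _≤∞_ : ℤ∞ → ℤ∞ → Set where
  fin≤fin : ∀ {m n} → m ℤ.≤ n → fin m ≤∞ fin n
  _≤∞∞    : ∀ x → x ≤∞ ∞

ordℚ : ℕ → ℚ → ℤ∞
ordℚ p (mkℚ (+ zero) d _) = ∞
ordℚ p (mkℚ n d _) = fin (ℤ.+ ordℕ p ∣ n ∣ ℤ.- ℤ.+ ordℕ p (suc d))

-- floor(x / p) for an integer x and a positive natural p (junk 0 for p = 0)
⌊_/_⌋ : ℤ → ℕ → ℤ
⌊ x / zero  ⌋ = ℤ.+ 0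
⌊ x / suc p ⌋ = x /ℕ suc p

-- Write R(t)(t+k) = A/B, where B is the product of the factors t + i (a ≤ i < b, i ≠ k) and A is
-- (b−a−1)!, times t + k when that factor does not cancel. At x₀ = −k every factor of B takes a
-- nonzero value i − k with |i − k| < p², hence of exact p-order v ≤ 1, and as its derivative is 1,
-- ord_p (t+i)⁽ⁿ⁾(x₀) ≥ v − n. Leibniz' rule carries such bounds over to products, so B(x₀) has exact
-- order e, the number of multiples of p among the i − k, and ord_p B⁽ⁿ⁾(x₀) ≥ e − n; similarly
-- ord_p A⁽ⁿ⁾(x₀) ≥ w − n with w = ⌊(b−a−1)/p⌋ (as p^⌊m/p⌋ divides m!), plus one when A contains
-- t + k, which vanishes at x₀. Each quotient-rule step (P/Q)' = (P'Q − PQ')/Q² keeps both bounds up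
-- to a common shift of exponent, so ord_p (R(t)(t+k))⁽ʲ⁾(−k) ≥ w − e − j, and counting multiples of
-- p by floors gives w − e = ⌊(b−a−1)/p⌋ − ⌊(k−a)/p⌋ − ⌊(b−1−k)/p⌋.

module Submission where

open import Defs
open import Data.Nat as ℕ using (ℕ; zero; suc; _^_; _!; NonZero; z≤n; s≤s)
import Data.Nat.Properties as ℕ
open import Data.Nat.DivMod using (m/n*n≤m)
import Data.Nat.Divisibility as ℕᵈ
open import Data.Nat.Primality using (Prime; euclidsLemma; prime⇒nonZero; prime⇒nonTrivial)
import Data.Nat.Tactic.RingSolver as ℕ-Solver
open import Data.Integer as ℤ using (ℤ; +_; -[1+_]; _+_; _-_; -_; _*_; ∣_∣; _≤_; _<_; _/ℕ_)
import Data.Integer.Properties as ℤ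
open import Data.Integer.DivMod using ([n/ℕd]*d≤n; n<s[n/ℕd]*d)
import Data.Integer.Divisibility.Signed as ℤᵈ
open import Data.Integer.GCD using (gcd-zeroʳ)
open import Data.Integer.Tactic.RingSolver using (solve-∀)
open import Data.Rational as ℚ using (mkℚ; _/_; ↥_; ↧_; 0ℚ)
import Data.Rational.Properties as ℚ
import Data.Rational.Unnormalised as ℚᵘ
open import Data.List using (List; []; _∷_; foldr)
open import Data.List.Properties using (foldr-cong)
open import Data.Product using (Σ-syntax; _×_; _,_)
open import Data.Sum using (_⊎_; inj₁; inj₂)
open import Relation.Binary.Bundles using (Setoid)
open import Relation.Nullary using (¬_; yes; no; contradiction)
open import Relation.Binary.PropositionalEquality

coeff : Poly → ℕ → ℤ
coeff []      _       = + 0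
coeff (x ∷ A) zero    = x
coeff (x ∷ A) (suc i) = coeff A i

infix 4 _≈ₚ_
record _≈ₚ_ (A B : Poly) : Set where
  constructor mk≈ₚ
  field coeff-≡ : ∀ i → coeff A i ≡ coeff B i
open _≈ₚ_

≈ₚ-setoid : Setoid _ _
≈ₚ-setoid = record
  { Carrier = Poly
  ; _≈_ = _≈ₚ_
  ; isEquivalence = record
    { refl = mk≈ₚ λ _ → refl
    ; sym = λ A≈B → mk≈ₚ λ i → sym (coeff-≡ A≈B i)
    ; trans = λ A≈B B≈C → mk≈ₚ λ i → trans (coeff-≡ A≈B i) (coeff-≡ B≈C i)
    }
  }

open Setoid ≈ₚ-setoid public using () renaming (refl to ≈ₚ-refl; sym to ≈ₚ-sym; trans to ≈ₚ-trans)

shiftₚ : Poly → Poly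
shiftₚ A = + 0 ∷ A

coeff-+ₚ : ∀ A B i → coeff (A +ₚ B) i ≡ coeff A i + coeff B i
coeff-+ₚ []      B       i       = sym (ℤ.+-identityˡ _)
coeff-+ₚ (x ∷ A) []      i       = sym (ℤ.+-identityʳ _)
coeff-+ₚ (x ∷ A) (y ∷ B) zero    = refl
coeff-+ₚ (x ∷ A) (y ∷ B) (suc i) = coeff-+ₚ A B i

coeff-·ₚ : ∀ c A i → coeff (c ·ₚ A) i ≡ c * coeff A i
coeff-·ₚ c []      i       = sym (ℤ.*-zeroʳ c)
coeff-·ₚ c (x ∷ A) zero    = refl
coeff-·ₚ c (x ∷ A) (suc i) = coeff-·ₚ c A i

coeff-derivAux : ∀ m A i → coeff (derivAux m A) i ≡ + (m ℕ.+ i) * coeff A i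
coeff-derivAux m []      i       = sym (ℤ.*-zeroʳ (+ (m ℕ.+ i)))
coeff-derivAux m (x ∷ A) zero    = cong (λ l → + l * x) (sym (ℕ.+-identityʳ m))
coeff-derivAux m (x ∷ A) (suc i) =
  trans (coeff-derivAux (suc m) A i) (cong (λ l → + l * coeff A i) (sym (ℕ.+-suc m i)))

coeff-derivₚ : ∀ A i → coeff (derivₚ A) i ≡ + suc i * coeff A (suc i)
coeff-derivₚ []      i = sym (ℤ.*-zeroʳ (+ suc i))
coeff-derivₚ (x ∷ A) i = coeff-derivAux 1 A i

+ₚ-cong : ∀ {A A′ B B′} → A ≈ₚ A′ → B ≈ₚ B′ → A +ₚ B ≈ₚ A′ +ₚ B′
+ₚ-cong {A} {A′} {B} {B′} A≈A′ B≈B′ = mk≈ₚ λ i → begin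
  coeff (A +ₚ B) i           ≡⟨ coeff-+ₚ A B i ⟩
  coeff A i + coeff B i      ≡⟨ cong₂ _+_ (coeff-≡ A≈A′ i) (coeff-≡ B≈B′ i) ⟩
  coeff A′ i + coeff B′ i    ≡⟨ coeff-+ₚ A′ B′ i ⟨
  coeff (A′ +ₚ B′) i         ∎
  where open ≡-Reasoning

∷-cong : ∀ x {A A′} → A ≈ₚ A′ → x ∷ A ≈ₚ x ∷ A′
∷-cong x A≈A′ = mk≈ₚ λ { zero → refl ; (suc i) → coeff-≡ A≈A′ i }

derivₚ-cong : ∀ {A A′} → A ≈ₚ A′ → derivₚ A ≈ₚ derivₚ A′
derivₚ-cong {A} {A′} A≈A′ = mk≈ₚ λ i → begin
  coeff (derivₚ A) i              ≡⟨ coeff-derivₚ A i ⟩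
  + suc i * coeff A (suc i)       ≡⟨ cong (+ suc i *_) (coeff-≡ A≈A′ (suc i)) ⟩
  + suc i * coeff A′ (suc i)      ≡⟨ coeff-derivₚ A′ i ⟨
  coeff (derivₚ A′) i             ∎
  where open ≡-Reasoning

derivₚ-+ₚ : ∀ A B → derivₚ (A +ₚ B) ≈ₚ derivₚ A +ₚ derivₚ B
derivₚ-+ₚ A B = mk≈ₚ λ i → begin
  coeff (derivₚ (A +ₚ B)) i                                 ≡⟨ coeff-derivₚ (A +ₚ B) i ⟩
  + suc i * coeff (A +ₚ B) (suc i)                          ≡⟨ cong (+ suc i *_) (coeff-+ₚ A B (suc i)) ⟩
  + suc i * (coeff A (suc i) + coeff B (suc i))             ≡⟨ ℤ.*-distribˡ-+ (+ suc i) (coeff A (suc i)) _ ⟩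
  + suc i * coeff A (suc i) + + suc i * coeff B (suc i)     ≡⟨ cong₂ _+_ (coeff-derivₚ A i) (coeff-derivₚ B i) ⟨
  coeff (derivₚ A) i + coeff (derivₚ B) i                   ≡⟨ coeff-+ₚ (derivₚ A) (derivₚ B) i ⟨
  coeff (derivₚ A +ₚ derivₚ B) i                            ∎
  where open ≡-Reasoning

derivₚ-·ₚ : ∀ c A → derivₚ (c ·ₚ A) ≈ₚ c ·ₚ derivₚ A
derivₚ-·ₚ c A = mk≈ₚ λ i → begin
  coeff (derivₚ (c ·ₚ A)) i             ≡⟨ coeff-derivₚ (c ·ₚ A) i ⟩
  + suc i * coeff (c ·ₚ A) (suc i)      ≡⟨ cong (+ suc i *_) (coeff-·ₚ c A (suc i)) ⟩
  + suc i * (c * coeff A (suc i))       ≡⟨ commute (+ suc i) c (coeff A (suc i)) ⟩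
  c * (+ suc i * coeff A (suc i))       ≡⟨ cong (c *_) (coeff-derivₚ A i) ⟨
  c * coeff (derivₚ A) i                ≡⟨ coeff-·ₚ c (derivₚ A) i ⟨
  coeff (c ·ₚ derivₚ A) i               ∎
  where
  open ≡-Reasoning
  commute : ∀ m c a → m * (c * a) ≡ c * (m * a)
  commute = solve-∀

derivₚ-shiftₚ : ∀ A → derivₚ (shiftₚ A) ≈ₚ A +ₚ shiftₚ (derivₚ A)
derivₚ-shiftₚ A = mk≈ₚ λ i → begin
  coeff (derivₚ (shiftₚ A)) i                     ≡⟨ coeff-derivₚ (shiftₚ A) i ⟩
  + suc i * coeff A i                             ≡⟨ split i ⟩
  coeff A i + coeff (shiftₚ (derivₚ A)) i         ≡⟨ coeff-+ₚ A (shiftₚ (derivₚ A)) i ⟨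
  coeff (A +ₚ shiftₚ (derivₚ A)) i                ∎
  where
  open ≡-Reasoning
  split : ∀ i → + suc i * coeff A i ≡ coeff A i + coeff (shiftₚ (derivₚ A)) i
  split zero    = trans (ℤ.*-identityˡ _) (sym (ℤ.+-identityʳ _))
  split (suc i) = trans (ℤ.suc-* (+ suc i) (coeff A (suc i)))
                        (cong (_+_ (coeff A (suc i))) (sym (coeff-derivₚ A i)))

*ₚ-zeroˡ : ∀ {A} B → A ≈ₚ [] → A *ₚ B ≈ₚ []
*ₚ-zeroˡ {[]}    B A≈0 = ≈ₚ-refl
*ₚ-zeroˡ {x ∷ A} B A≈0 = mk≈ₚ λ i → begin
  coeff (x ·ₚ B +ₚ shiftₚ (A *ₚ B)) i
    ≡⟨ coeff-+ₚ (x ·ₚ B) _ i ⟩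
  coeff (x ·ₚ B) i + coeff (shiftₚ (A *ₚ B)) i
    ≡⟨ cong₂ _+_ (trans (coeff-·ₚ x B i) (cong (_* coeff B i) (coeff-≡ A≈0 0)))
                 (coeff-≡ (∷-cong (+ 0) (*ₚ-zeroˡ {A} B (mk≈ₚ λ j → coeff-≡ A≈0 (suc j)))) i) ⟩
  + 0 * coeff B i + coeff (shiftₚ []) i
    ≡⟨ vanishes i ⟩
  + 0 ∎
  where
  open ≡-Reasoning
  vanishes : ∀ i → + 0 * coeff B i + coeff (shiftₚ []) i ≡ + 0
  vanishes zero    = refl
  vanishes (suc i) = refl

*ₚ-congˡ : ∀ {A A′} B → A ≈ₚ A′ → A *ₚ B ≈ₚ A′ *ₚ B
*ₚ-congˡ {[]}    {[]}     B A≈A′ = ≈ₚ-refl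
*ₚ-congˡ {[]}    {y ∷ A′} B A≈A′ = ≈ₚ-sym (*ₚ-zeroˡ B (≈ₚ-sym A≈A′))
*ₚ-congˡ {x ∷ A} {[]}     B A≈A′ = *ₚ-zeroˡ B A≈A′
*ₚ-congˡ {x ∷ A} {y ∷ A′} B A≈A′ rewrite coeff-≡ A≈A′ 0 =
  +ₚ-cong ≈ₚ-refl (∷-cong (+ 0) (*ₚ-congˡ {A} {A′} B (mk≈ₚ λ i → coeff-≡ A≈A′ (suc i))))

shiftₚ-+ₚ : ∀ A B → shiftₚ (A +ₚ B) ≈ₚ shiftₚ A +ₚ shiftₚ B
shiftₚ-+ₚ A B = ≈ₚ-refl

*ₚ-distribʳ-+ₚ : ∀ A B C → (A +ₚ B) *ₚ C ≈ₚ A *ₚ C +ₚ B *ₚ C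
*ₚ-distribʳ-+ₚ []      B       C = ≈ₚ-refl
*ₚ-distribʳ-+ₚ (x ∷ A) []      C = mk≈ₚ λ i → trans (sym (ℤ.+-identityʳ _)) (sym (coeff-+ₚ ((x ∷ A) *ₚ C) [] i))
*ₚ-distribʳ-+ₚ (x ∷ A) (y ∷ B) C = mk≈ₚ λ i → begin
  coeff ((x + y) ·ₚ C +ₚ shiftₚ ((A +ₚ B) *ₚ C)) i
    ≡⟨ coeff-+ₚ ((x + y) ·ₚ C) _ i ⟩
  coeff ((x + y) ·ₚ C) i + coeff (shiftₚ ((A +ₚ B) *ₚ C)) i
    ≡⟨ cong₂ _+_ (coeff-·ₚ (x + y) C i) (coeff-≡ (∷-cong (+ 0) (*ₚ-distribʳ-+ₚ A B C)) i) ⟩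
  (x + y) * coeff C i + coeff (shiftₚ (A *ₚ C +ₚ B *ₚ C)) i
    ≡⟨ cong (_+_ ((x + y) * coeff C i))
            (trans (coeff-≡ (shiftₚ-+ₚ (A *ₚ C) (B *ₚ C)) i) (coeff-+ₚ (shiftₚ (A *ₚ C)) (shiftₚ (B *ₚ C)) i)) ⟩
  (x + y) * coeff C i + (coeff (shiftₚ (A *ₚ C)) i + coeff (shiftₚ (B *ₚ C)) i)
    ≡⟨ distrib x y (coeff C i) _ _ ⟩
  (x * coeff C i + coeff (shiftₚ (A *ₚ C)) i) + (y * coeff C i + coeff (shiftₚ (B *ₚ C)) i)
    ≡⟨ cong₂ _+_ (summand x A i) (summand y B i) ⟨
  coeff (x ·ₚ C +ₚ shiftₚ (A *ₚ C)) i + coeff (y ·ₚ C +ₚ shiftₚ (B *ₚ C)) i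
    ≡⟨ coeff-+ₚ (x ·ₚ C +ₚ shiftₚ (A *ₚ C)) _ i ⟨
  coeff ((x ·ₚ C +ₚ shiftₚ (A *ₚ C)) +ₚ (y ·ₚ C +ₚ shiftₚ (B *ₚ C))) i ∎
  where
  open ≡-Reasoning
  distrib : ∀ x y c u v → (x + y) * c + (u + v) ≡ (x * c + u) + (y * c + v)
  distrib = solve-∀
  summand : ∀ z D i → coeff (z ·ₚ C +ₚ shiftₚ (D *ₚ C)) i ≡ z * coeff C i + coeff (shiftₚ (D *ₚ C)) i
  summand z D i = trans (coeff-+ₚ (z ·ₚ C) _ i) (cong (_+ coeff (shiftₚ (D *ₚ C)) i) (coeff-·ₚ z C i))

shiftₚ-*ₚ : ∀ A B → shiftₚ A *ₚ B ≈ₚ shiftₚ (A *ₚ B)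
shiftₚ-*ₚ A B = mk≈ₚ λ i → begin
  coeff (+ 0 ·ₚ B +ₚ shiftₚ (A *ₚ B)) i               ≡⟨ coeff-+ₚ (+ 0 ·ₚ B) _ i ⟩
  coeff (+ 0 ·ₚ B) i + coeff (shiftₚ (A *ₚ B)) i      ≡⟨ cong (_+ coeff (shiftₚ (A *ₚ B)) i) (coeff-·ₚ (+ 0) B i) ⟩
  + 0 * coeff B i + coeff (shiftₚ (A *ₚ B)) i         ≡⟨ ℤ.+-identityˡ _ ⟩
  coeff (shiftₚ (A *ₚ B)) i                           ∎
  where open ≡-Reasoning

+ₚ-interchange : ∀ P Q R S → P +ₚ (Q +ₚ (R +ₚ S)) ≈ₚ (Q +ₚ R) +ₚ (P +ₚ S)
+ₚ-interchange P Q R S = mk≈ₚ λ i → begin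
  coeff (P +ₚ (Q +ₚ (R +ₚ S))) i
    ≡⟨ trans (coeff-+ₚ P _ i) (cong (_+_ (coeff P i)) (trans (coeff-+ₚ Q _ i) (cong (_+_ (coeff Q i)) (coeff-+ₚ R S i)))) ⟩
  coeff P i + (coeff Q i + (coeff R i + coeff S i))
    ≡⟨ interchange (coeff P i) (coeff Q i) (coeff R i) (coeff S i) ⟩
  (coeff Q i + coeff R i) + (coeff P i + coeff S i)
    ≡⟨ trans (coeff-+ₚ (Q +ₚ R) _ i) (cong₂ _+_ (coeff-+ₚ Q R i) (coeff-+ₚ P S i)) ⟨
  coeff ((Q +ₚ R) +ₚ (P +ₚ S)) i ∎
  where
  open ≡-Reasoning
  interchange : ∀ p q r s → p + (q + (r + s)) ≡ (q + r) + (p + s)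
  interchange = solve-∀

derivₚ-*ₚ : ∀ A B → derivₚ (A *ₚ B) ≈ₚ derivₚ A *ₚ B +ₚ A *ₚ derivₚ B
derivₚ-*ₚ []      B = ≈ₚ-refl
derivₚ-*ₚ (x ∷ A) B = begin
  derivₚ (x ·ₚ B +ₚ shiftₚ (A *ₚ B))
    ≈⟨ derivₚ-+ₚ (x ·ₚ B) (shiftₚ (A *ₚ B)) ⟩
  derivₚ (x ·ₚ B) +ₚ derivₚ (shiftₚ (A *ₚ B))
    ≈⟨ +ₚ-cong (derivₚ-·ₚ x B) (derivₚ-shiftₚ (A *ₚ B)) ⟩
  x ·ₚ B′ +ₚ (A *ₚ B +ₚ shiftₚ (derivₚ (A *ₚ B)))
    ≈⟨ +ₚ-cong (≈ₚ-refl {x ·ₚ B′}) (+ₚ-cong (≈ₚ-refl {A *ₚ B}) (∷-cong (+ 0) (derivₚ-*ₚ A B))) ⟩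
  x ·ₚ B′ +ₚ (A *ₚ B +ₚ shiftₚ (A′ *ₚ B +ₚ A *ₚ B′))
    ≈⟨ +ₚ-cong (≈ₚ-refl {x ·ₚ B′}) (+ₚ-cong (≈ₚ-refl {A *ₚ B}) (shiftₚ-+ₚ (A′ *ₚ B) (A *ₚ B′))) ⟩
  x ·ₚ B′ +ₚ (A *ₚ B +ₚ (shiftₚ (A′ *ₚ B) +ₚ shiftₚ (A *ₚ B′)))
    ≈⟨ +ₚ-interchange (x ·ₚ B′) (A *ₚ B) (shiftₚ (A′ *ₚ B)) (shiftₚ (A *ₚ B′)) ⟩
  (A *ₚ B +ₚ shiftₚ (A′ *ₚ B)) +ₚ (x ·ₚ B′ +ₚ shiftₚ (A *ₚ B′))
    ≈⟨ +ₚ-cong (+ₚ-cong (≈ₚ-refl {A *ₚ B}) (shiftₚ-*ₚ A′ B)) (≈ₚ-refl {(x ∷ A) *ₚ B′}) ⟨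
  (A *ₚ B +ₚ shiftₚ A′ *ₚ B) +ₚ (x ∷ A) *ₚ B′
    ≈⟨ +ₚ-cong (*ₚ-distribʳ-+ₚ A (shiftₚ A′) B) (≈ₚ-refl {(x ∷ A) *ₚ B′}) ⟨
  (A +ₚ shiftₚ A′) *ₚ B +ₚ (x ∷ A) *ₚ B′
    ≈⟨ +ₚ-cong (*ₚ-congˡ B (derivₚ-shiftₚ A)) (≈ₚ-refl {(x ∷ A) *ₚ B′}) ⟨
  derivₚ (x ∷ A) *ₚ B +ₚ (x ∷ A) *ₚ B′ ∎
  where
  open import Relation.Binary.Reasoning.Setoid ≈ₚ-setoid
  A′ = derivₚ A
  B′ = derivₚ B

evalₚ-≈[] : ∀ {A} x → A ≈ₚ [] → evalₚ A x ≡ + 0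
evalₚ-≈[] {[]}    x A≈0 = refl
evalₚ-≈[] {y ∷ A} x A≈0 = begin
  y + x * evalₚ A x
    ≡⟨ cong₂ (λ u v → u + x * v) (coeff-≡ A≈0 0) (evalₚ-≈[] {A} x (mk≈ₚ λ i → coeff-≡ A≈0 (suc i))) ⟩
  + 0 + x * + 0
    ≡⟨ trans (ℤ.+-identityˡ _) (ℤ.*-zeroʳ x) ⟩
  + 0 ∎
  where open ≡-Reasoning

evalₚ-cong : ∀ {A B} x → A ≈ₚ B → evalₚ A x ≡ evalₚ B x
evalₚ-cong {[]}    {B}     x A≈B = sym (evalₚ-≈[] x (≈ₚ-sym A≈B))
evalₚ-cong {y ∷ A} {[]}    x A≈B = evalₚ-≈[] x A≈B
evalₚ-cong {y ∷ A} {z ∷ B} x A≈B =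
  cong₂ (λ u v → u + x * v) (coeff-≡ A≈B 0) (evalₚ-cong {A} {B} x (mk≈ₚ λ i → coeff-≡ A≈B (suc i)))

evalₚ-+ₚ : ∀ A B x → evalₚ (A +ₚ B) x ≡ evalₚ A x + evalₚ B x
evalₚ-+ₚ []      B       x = sym (ℤ.+-identityˡ _)
evalₚ-+ₚ (y ∷ A) []      x = sym (ℤ.+-identityʳ _)
evalₚ-+ₚ (y ∷ A) (z ∷ B) x = begin
  (y + z) + x * evalₚ (A +ₚ B) x                 ≡⟨ cong (λ v → (y + z) + x * v) (evalₚ-+ₚ A B x) ⟩
  (y + z) + x * (evalₚ A x + evalₚ B x)          ≡⟨ horner y z x (evalₚ A x) (evalₚ B x) ⟩
  (y + x * evalₚ A x) + (z + x * evalₚ B x)      ∎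
  where
  open ≡-Reasoning
  horner : ∀ y z x a b → (y + z) + x * (a + b) ≡ (y + x * a) + (z + x * b)
  horner = solve-∀

evalₚ-·ₚ : ∀ c A x → evalₚ (c ·ₚ A) x ≡ c * evalₚ A x
evalₚ-·ₚ c []      x = sym (ℤ.*-zeroʳ c)
evalₚ-·ₚ c (y ∷ A) x = begin
  c * y + x * evalₚ (c ·ₚ A) x      ≡⟨ cong (λ v → c * y + x * v) (evalₚ-·ₚ c A x) ⟩
  c * y + x * (c * evalₚ A x)       ≡⟨ horner c y x (evalₚ A x) ⟩
  c * (y + x * evalₚ A x)           ∎
  where
  open ≡-Reasoning
  horner : ∀ c y x a → c * y + x * (c * a) ≡ c * (y + x * a)
  horner = solve-∀

evalₚ-*ₚ : ∀ A B x → evalₚ (A *ₚ B) x ≡ evalₚ A x * evalₚ B x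
evalₚ-*ₚ []      B x = refl
evalₚ-*ₚ (y ∷ A) B x = begin
  evalₚ (y ·ₚ B +ₚ shiftₚ (A *ₚ B)) x                    ≡⟨ evalₚ-+ₚ (y ·ₚ B) (shiftₚ (A *ₚ B)) x ⟩
  evalₚ (y ·ₚ B) x + (+ 0 + x * evalₚ (A *ₚ B) x)        ≡⟨ cong₂ (λ u v → u + (+ 0 + x * v)) (evalₚ-·ₚ y B x) (evalₚ-*ₚ A B x) ⟩
  y * evalₚ B x + (+ 0 + x * (evalₚ A x * evalₚ B x))    ≡⟨ horner y x (evalₚ A x) (evalₚ B x) ⟩
  (y + x * evalₚ A x) * evalₚ B x                        ∎
  where
  open ≡-Reasoning
  horner : ∀ y x a b → y * b + (+ 0 + x * (a * b)) ≡ (y + x * a) * b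
  horner = solve-∀


deriv^ₚ : ℕ → Poly → Poly
deriv^ₚ zero    A = A
deriv^ₚ (suc n) A = deriv^ₚ n (derivₚ A)

deriv^ₚ-cong : ∀ n {A B} → A ≈ₚ B → deriv^ₚ n A ≈ₚ deriv^ₚ n B
deriv^ₚ-cong zero    A≈B = A≈B
deriv^ₚ-cong (suc n) A≈B = deriv^ₚ-cong n (derivₚ-cong A≈B)

deriv^ₚ-+ₚ : ∀ n A B → deriv^ₚ n (A +ₚ B) ≈ₚ deriv^ₚ n A +ₚ deriv^ₚ n B
deriv^ₚ-+ₚ zero    A B = ≈ₚ-refl
deriv^ₚ-+ₚ (suc n) A B = ≈ₚ-trans (deriv^ₚ-cong n (derivₚ-+ₚ A B)) (deriv^ₚ-+ₚ n (derivₚ A) (derivₚ B))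

deriv^ₚ-·ₚ : ∀ n c A → deriv^ₚ n (c ·ₚ A) ≈ₚ c ·ₚ deriv^ₚ n A
deriv^ₚ-·ₚ zero    c A = ≈ₚ-refl
deriv^ₚ-·ₚ (suc n) c A = ≈ₚ-trans (deriv^ₚ-cong n (derivₚ-·ₚ c A)) (deriv^ₚ-·ₚ n c (derivₚ A))

deriv^ₚ-[] : ∀ n → deriv^ₚ n [] ≡ []
deriv^ₚ-[] zero    = refl
deriv^ₚ-[] (suc n) = deriv^ₚ-[] n

∂ : ℕ → Poly → ℤ → ℤ
∂ n A x = evalₚ (deriv^ₚ n A) x

∂-cong : ∀ n {A B} x → A ≈ₚ B → ∂ n A x ≡ ∂ n B x
∂-cong n x A≈B = evalₚ-cong x (deriv^ₚ-cong n A≈B)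

∂-+ₚ : ∀ n A B x → ∂ n (A +ₚ B) x ≡ ∂ n A x + ∂ n B x
∂-+ₚ n A B x = trans (evalₚ-cong x (deriv^ₚ-+ₚ n A B)) (evalₚ-+ₚ (deriv^ₚ n A) (deriv^ₚ n B) x)

∂-·ₚ : ∀ n c A x → ∂ n (c ·ₚ A) x ≡ c * ∂ n A x
∂-·ₚ n c A x = trans (evalₚ-cong x (deriv^ₚ-·ₚ n c A)) (evalₚ-·ₚ c (deriv^ₚ n A) x)

∂-suc-*ₚ : ∀ n A B x → ∂ (suc n) (A *ₚ B) x ≡ ∂ n (derivₚ A *ₚ B) x + ∂ n (A *ₚ derivₚ B) x
∂-suc-*ₚ n A B x = trans (∂-cong n x (derivₚ-*ₚ A B)) (∂-+ₚ n (derivₚ A *ₚ B) (A *ₚ derivₚ B) x)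

∂-[] : ∀ n x → ∂ n [] x ≡ + 0
∂-[] n x = cong (λ A → evalₚ A x) (deriv^ₚ-[] n)

∂-constₚ : ∀ c x → ∂ 0 (constₚ c) x ≡ c
∂-constₚ c x = trans (cong (_+_ c) (ℤ.*-zeroʳ x)) (ℤ.+-identityʳ c)

∂-linear : ∀ a b x → ∂ 1 (a ∷ b ∷ []) x ≡ b
∂-linear a b x = trans (cong (_+_ (+ 1 * b)) (ℤ.*-zeroʳ x)) (trans (ℤ.+-identityʳ _) (ℤ.*-identityˡ b))

*-pres-∣ᶻ : ∀ {i j m n} → i ℤᵈ.∣ m → j ℤᵈ.∣ n → i * j ℤᵈ.∣ m * n
*-pres-∣ᶻ {i} {j} (ℤᵈ.divides q refl) (ℤᵈ.divides r refl) = ℤᵈ.divides (q * r) (interchange q i r j)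
  where
  interchange : ∀ q i r j → (q * i) * (r * j) ≡ (q * r) * (i * j)
  interchange = solve-∀

module OrdBounds (p : ℕ) (x₀ : ℤ) where

  open ℤᵈ using (_∣_; divides; ∣m∣n⇒∣m+n; ∣n⇒∣m*n)

  p^_ : ℕ → ℤ
  p^ w = + (p ^ w)

  p^-+ : ∀ m n → p^ (m ℕ.+ n) ≡ p^ m * p^ n
  p^-+ m n = trans (cong +_ (ℕ.^-distribˡ-+-* p m n)) (ℤ.pos-* (p ^ m) (p ^ n))

  -- OrdBound A w s says ord_p A⁽ⁿ⁾(x₀) ≥ w − s − n for every n, without subtracting exponents.
  record OrdBound (A : Poly) (w s : ℕ) : Set where
    constructor ordBound
    field divides-∂ : ∀ n → p^ w ∣ p^ (n ℕ.+ s) * ∂ n A x₀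
  open OrdBound public

  OrdBound-+ₚ : ∀ {A B w s} → OrdBound A w s → OrdBound B w s → OrdBound (A +ₚ B) w s
  OrdBound-+ₚ {A} {B} {w} {s} bA bB = ordBound λ n →
    subst (p^ w ∣_)
      (trans (sym (ℤ.*-distribˡ-+ (p^ (n ℕ.+ s)) (∂ n A x₀) (∂ n B x₀))) (cong (p^ (n ℕ.+ s) *_) (sym (∂-+ₚ n A B x₀))))
      (∣m∣n⇒∣m+n (divides-∂ bA n) (divides-∂ bB n))

  OrdBound-·ₚ : ∀ {A w s} c → OrdBound A w s → OrdBound (c ·ₚ A) w s
  OrdBound-·ₚ {A} {w} {s} c bA = ordBound λ n →
    subst (p^ w ∣_) (trans (commute c (p^ (n ℕ.+ s)) (∂ n A x₀)) (cong (p^ (n ℕ.+ s) *_) (sym (∂-·ₚ n c A x₀))))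
          (∣n⇒∣m*n c (divides-∂ bA n))
    where
    commute : ∀ c q d → c * (q * d) ≡ q * (c * d)
    commute = solve-∀

  OrdBound-derivₚ : ∀ {A w s} → OrdBound A w s → OrdBound (derivₚ A) w (suc s)
  OrdBound-derivₚ {A} {w} {s} bA = ordBound λ n →
    subst (λ m → p^ w ∣ p^ m * ∂ (suc n) A x₀) (sym (ℕ.+-suc n s)) (divides-∂ bA (suc n))

  OrdBound-*ₚ : ∀ {A B w₁ w₂ s₁ s₂} → OrdBound A w₁ s₁ → OrdBound B w₂ s₂ →
                OrdBound (A *ₚ B) (w₁ ℕ.+ w₂) (s₁ ℕ.+ s₂)
  OrdBound-*ₚ bA bB = ordBound λ n → leibniz n bA bB
    where
    leibniz : ∀ n {A B w₁ w₂ s₁ s₂} → OrdBound A w₁ s₁ → OrdBound B w₂ s₂ →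
              p^ (w₁ ℕ.+ w₂) ∣ p^ (n ℕ.+ (s₁ ℕ.+ s₂)) * ∂ n (A *ₚ B) x₀
    leibniz zero {A} {B} {w₁} {w₂} {s₁} {s₂} bA bB =
      subst₂ _∣_ (sym (p^-+ w₁ w₂)) product (*-pres-∣ᶻ (divides-∂ bA 0) (divides-∂ bB 0))
      where
      open ≡-Reasoning
      interchange : ∀ a b c d → (a * b) * (c * d) ≡ (a * c) * (b * d)
      interchange = solve-∀
      product : (p^ s₁ * ∂ 0 A x₀) * (p^ s₂ * ∂ 0 B x₀) ≡ p^ (s₁ ℕ.+ s₂) * ∂ 0 (A *ₚ B) x₀
      product = begin
        (p^ s₁ * ∂ 0 A x₀) * (p^ s₂ * ∂ 0 B x₀)   ≡⟨ interchange (p^ s₁) (∂ 0 A x₀) (p^ s₂) (∂ 0 B x₀) ⟩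
        (p^ s₁ * p^ s₂) * (∂ 0 A x₀ * ∂ 0 B x₀)   ≡⟨ cong₂ _*_ (p^-+ s₁ s₂) (evalₚ-*ₚ A B x₀) ⟨
        p^ (s₁ ℕ.+ s₂) * ∂ 0 (A *ₚ B) x₀          ∎
    leibniz (suc n) {A} {B} {w₁} {w₂} {s₁} {s₂} bA bB =
      subst (p^ (w₁ ℕ.+ w₂) ∣_) sum
        (∣m∣n⇒∣m+n (leibniz n (OrdBound-derivₚ bA) bB) (leibniz n bA (OrdBound-derivₚ bB)))
      where
      open ≡-Reasoning
      exponentˡ : ∀ n s₁ s₂ → n ℕ.+ (suc s₁ ℕ.+ s₂) ≡ suc n ℕ.+ (s₁ ℕ.+ s₂)
      exponentˡ = ℕ-Solver.solve-∀
      exponentʳ : ∀ n s₁ s₂ → n ℕ.+ (s₁ ℕ.+ suc s₂) ≡ suc n ℕ.+ (s₁ ℕ.+ s₂)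
      exponentʳ = ℕ-Solver.solve-∀
      P = p^ (suc n ℕ.+ (s₁ ℕ.+ s₂))
      sum : p^ (n ℕ.+ (suc s₁ ℕ.+ s₂)) * ∂ n (derivₚ A *ₚ B) x₀ + p^ (n ℕ.+ (s₁ ℕ.+ suc s₂)) * ∂ n (A *ₚ derivₚ B) x₀
            ≡ P * ∂ (suc n) (A *ₚ B) x₀
      sum = begin
        p^ (n ℕ.+ (suc s₁ ℕ.+ s₂)) * ∂ n (derivₚ A *ₚ B) x₀ + p^ (n ℕ.+ (s₁ ℕ.+ suc s₂)) * ∂ n (A *ₚ derivₚ B) x₀
          ≡⟨ cong₂ (λ l m → p^ l * ∂ n (derivₚ A *ₚ B) x₀ + p^ m * ∂ n (A *ₚ derivₚ B) x₀)
                   (exponentˡ n s₁ s₂) (exponentʳ n s₁ s₂) ⟩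
        P * ∂ n (derivₚ A *ₚ B) x₀ + P * ∂ n (A *ₚ derivₚ B) x₀
          ≡⟨ ℤ.*-distribˡ-+ P _ _ ⟨
        P * (∂ n (derivₚ A *ₚ B) x₀ + ∂ n (A *ₚ derivₚ B) x₀)
          ≡⟨ cong (P *_) (∂-suc-*ₚ n A B x₀) ⟨
        P * ∂ (suc n) (A *ₚ B) x₀ ∎

  OrdBound-constₚ : ∀ {c w} → p^ w ∣ c → OrdBound (constₚ c) w 0
  OrdBound-constₚ {c} {w} p^w∣c = ordBound λ
    { zero    → subst (p^ w ∣_) (sym (trans (ℤ.*-identityˡ _) (∂-constₚ c x₀))) p^w∣c
    ; (suc n) → subst (λ z → p^ w ∣ p^ (suc n ℕ.+ 0) * z) (sym (∂-[] n x₀)) (divides (+ 0) (ℤ.*-zeroʳ (p^ (suc n ℕ.+ 0))))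
    }

  OrdBound-linear : ∀ {a b w} → p^ w ∣ evalₚ (a ∷ b ∷ []) x₀ → p^ w ∣ p^ 1 * b → OrdBound (a ∷ b ∷ []) w 0
  OrdBound-linear {a} {b} {w} p^w∣value p^w∣p*b = ordBound λ
    { zero          → subst (p^ w ∣_) (sym (ℤ.*-identityˡ _)) p^w∣value
    ; (suc zero)    → subst (λ z → p^ w ∣ p^ 1 * z) (sym (∂-linear a b x₀)) p^w∣p*b
    ; (suc (suc n)) → subst (λ z → p^ w ∣ p^ (suc (suc n) ℕ.+ 0) * z) (sym (∂-[] n x₀))
                            (divides (+ 0) (ℤ.*-zeroʳ (p^ (suc (suc n) ℕ.+ 0))))
    }

⌊/⌋≡/ℕ : ∀ x p .{{_ : NonZero p}} → ⌊ x / p ⌋ ≡ x /ℕ p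
⌊/⌋≡/ℕ x (ℕ.suc p) = refl

module Floors (p : ℕ) .{{_ : NonZero p}} where

  open ℤᵈ using (_∣_; divides)

  private
    P : ℤ
    P = + p

    <-suc⇒≤ : ∀ {i j} → i < ℤ.suc j → i ≤ j
    <-suc⇒≤ {i} {j} i<suc[j] = subst (i ≤_) (ℤ.pred-suc j) (ℤ.i<j⇒i≤pred[j] i<suc[j])

    *P-cancel-< : ∀ {i j} → i * P < j * P → i < j
    *P-cancel-< = ℤ.*-cancelʳ-<-nonNeg P

    suc[i-1] : ∀ i → + 1 + (i - + 1) ≡ i
    suc[i-1] = solve-∀

    i-1<i : ∀ i → i - + 1 < i
    i-1<i i = ℤ.suc[i]≤j⇒i<j (ℤ.≤-reflexive (suc[i-1] i))

    0<P : + 0 < P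
    0<P = ℤ.+<+ (ℕ.>-nonZero⁻¹ p)

  ⌊/⌋*p≤ : ∀ x → ⌊ x / p ⌋ * P ≤ x
  ⌊/⌋*p≤ x = subst (λ q → q * P ≤ x) (sym (⌊/⌋≡/ℕ x p)) ([n/ℕd]*d≤n x p)

  <suc[⌊/⌋]*p : ∀ x → x < ℤ.suc ⌊ x / p ⌋ * P
  <suc[⌊/⌋]*p x = subst (λ q → x < ℤ.suc q * P) (sym (⌊/⌋≡/ℕ x p)) (n<s[n/ℕd]*d x p)

  ⌊/⌋-unique : ∀ {x q} → q * P ≤ x → x < ℤ.suc q * P → ⌊ x / p ⌋ ≡ q
  ⌊/⌋-unique {x} {q} q*P≤x x<suc[q]*P = ℤ.≤-antisym
    (<-suc⇒≤ (*P-cancel-< (ℤ.≤-<-trans (⌊/⌋*p≤ x) x<suc[q]*P)))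
    (<-suc⇒≤ (*P-cancel-< (ℤ.≤-<-trans q*P≤x (<suc[⌊/⌋]*p x))))

  ⌊/⌋-neg : ∀ x → ⌊ - x - + 1 / p ⌋ ≡ - ⌊ x / p ⌋ - + 1
  ⌊/⌋-neg x = ⌊/⌋-unique lower upper
    where
    q = ⌊ x / p ⌋
    neg-suc : ∀ x → - x - + 1 ≡ - (+ 1 + x)
    neg-suc = solve-∀
    suc-neg-suc : ∀ x → + 1 + (- x - + 1) ≡ - x
    suc-neg-suc = solve-∀
    neg-suc-* : ∀ q P → (- q - + 1) * P ≡ - ((+ 1 + q) * P)
    neg-suc-* = solve-∀
    suc-neg-suc-* : ∀ q P → (+ 1 + (- q - + 1)) * P ≡ - (q * P)
    suc-neg-suc-* = solve-∀
    lower : (- q - + 1) * P ≤ - x - + 1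
    lower = subst₂ _≤_ (sym (neg-suc-* q P)) (sym (neg-suc x)) (ℤ.neg-mono-≤ (ℤ.i<j⇒suc[i]≤j (<suc[⌊/⌋]*p x)))
    upper : - x - + 1 < ℤ.suc (- q - + 1) * P
    upper = ℤ.suc[i]≤j⇒i<j (subst₂ _≤_ (sym (suc-neg-suc x)) (sym (suc-neg-suc-* q P)) (ℤ.neg-mono-≤ (⌊/⌋*p≤ x)))

  ⌊/⌋-step-∣ : ∀ {c} → P ∣ c → ⌊ c / p ⌋ ≡ ⌊ c - + 1 / p ⌋ + + 1
  ⌊/⌋-step-∣ {c} (divides m refl) = begin
    ⌊ m * P / p ⌋                 ≡⟨ ⌊/⌋-unique ℤ.≤-refl m*P<suc[m]*P ⟩
    m                             ≡⟨ suc[i-1] m ⟨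
    + 1 + (m - + 1)               ≡⟨ cong (_+_ (+ 1)) (⌊/⌋-unique {q = m - + 1} lower upper) ⟨
    + 1 + ⌊ m * P - + 1 / p ⌋     ≡⟨ ℤ.+-comm (+ 1) ⌊ m * P - + 1 / p ⌋ ⟩
    ⌊ m * P - + 1 / p ⌋ + + 1     ∎
    where
    open ≡-Reasoning
    pred-* : ∀ m P → (m - + 1) * P ≡ m * P - P
    pred-* = solve-∀
    m*P<suc[m]*P : m * P < ℤ.suc m * P
    m*P<suc[m]*P = subst₂ _<_ (ℤ.+-identityˡ (m * P)) (sym (ℤ.suc-* m P)) (ℤ.+-monoˡ-< (m * P) 0<P)
    lower : (m - + 1) * P ≤ m * P - + 1
    lower = subst (_≤ m * P - + 1) (sym (pred-* m P)) (ℤ.+-monoʳ-≤ (m * P) (ℤ.neg-mono-≤ (ℤ.i<j⇒suc[i]≤j 0<P)))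
    upper : m * P - + 1 < ℤ.suc (m - + 1) * P
    upper = subst (m * P - + 1 <_) (cong (_* P) (sym (suc[i-1] m))) (i-1<i (m * P))

  ⌊/⌋-step-∤ : ∀ {c} → ¬ P ∣ c → ⌊ c / p ⌋ ≡ ⌊ c - + 1 / p ⌋
  ⌊/⌋-step-∤ {c} P∤c = ⌊/⌋-unique lower upper
    where
    q = ⌊ c - + 1 / p ⌋
    lower : q * P ≤ c
    lower = ℤ.≤-trans (⌊/⌋*p≤ (c - + 1)) (ℤ.<⇒≤ (i-1<i c))
    upper : c < ℤ.suc q * P
    upper = ℤ.≤∧≢⇒< (subst (_≤ ℤ.suc q * P) (suc[i-1] c) (ℤ.i<j⇒suc[i]≤j (<suc[⌊/⌋]*p (c - + 1))))
                    (λ c≡ → P∤c (divides (ℤ.suc q) c≡))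

  -- ⌊(c+n−1)/p⌋ − ⌊(c−1)/p⌋ counts the multiples of p among c, c+1, …, c+n−1
  multiples : ℤ → ℕ → ℤ
  multiples c n = ⌊ c + + n - + 1 / p ⌋ - ⌊ c - + 1 / p ⌋

  multiples-zero : ∀ c → multiples c 0 ≡ + 0
  multiples-zero c = trans (cong (λ x → ⌊ x - + 1 / p ⌋ - ⌊ c - + 1 / p ⌋) (ℤ.+-identityʳ c)) (ℤ.+-inverseʳ ⌊ c - + 1 / p ⌋)

  multiples-suc : ∀ c n {v} → ⌊ c + + n / p ⌋ ≡ ⌊ c + + n - + 1 / p ⌋ + v → multiples c (suc n) ≡ multiples c n + v
  multiples-suc c n {v} jump = begin
    ⌊ c + (+ 1 + + n) - + 1 / p ⌋ - ⌊ c - + 1 / p ⌋    ≡⟨ cong (λ x → ⌊ x / p ⌋ - ⌊ c - + 1 / p ⌋) (cancel c (+ n)) ⟩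
    ⌊ c + + n / p ⌋ - ⌊ c - + 1 / p ⌋                  ≡⟨ cong (_- ⌊ c - + 1 / p ⌋) jump ⟩
    ⌊ c + + n - + 1 / p ⌋ + v - ⌊ c - + 1 / p ⌋        ≡⟨ swap ⌊ c + + n - + 1 / p ⌋ v ⌊ c - + 1 / p ⌋ ⟩
    multiples c n + v                                  ∎
    where
    open ≡-Reasoning
    cancel : ∀ c n → c + (+ 1 + n) - + 1 ≡ c + n
    cancel = solve-∀
    swap : ∀ x v y → x + v - y ≡ x - y + v
    swap = solve-∀

p^q∣[q*p]! : ∀ p q .{{_ : NonZero p}} → p ^ q ℕᵈ.∣ (q ℕ.* p) !
p^q∣[q*p]! p       zero    = ℕᵈ.1∣ 1
p^q∣[q*p]! (suc p) (suc q) =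
  ℕᵈ.*-pres-∣ {suc p} {suc q ℕ.* suc p} (ℕᵈ.n∣m*n (suc q))
              (ℕᵈ.∣-trans (p^q∣[q*p]! (suc p) q) (ℕᵈ.m≤n⇒m!∣n! (ℕ.m≤n+m (q ℕ.* suc p) p)))

p^[n/p]∣n! : ∀ p n .{{_ : NonZero p}} → p ^ (n ℕ./ p) ℕᵈ.∣ n !
p^[n/p]∣n! p n = ℕᵈ.∣-trans (p^q∣[q*p]! p (n ℕ./ p)) (ℕᵈ.m≤n⇒m!∣n! (m/n*n≤m n p))

↥-/1 : ∀ i → ↥ (i / 1) ≡ i
↥-/1 i = trans (sym (ℤ.*-identityʳ _)) (trans (cong (↥ (i / 1) *_) (sym (gcd-zeroʳ i))) (ℚ.↥-/ i 1))

↧-/1 : ∀ i → ↧ (i / 1) ≡ + 1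
↧-/1 i = trans (sym (ℤ.*-identityʳ _)) (trans (cong (↧ (i / 1) *_) (sym (gcd-zeroʳ i))) (ℚ.↧-/ i 1))

*-cross : ∀ q r s → q ℚ.* r ≡ s → ↥ s * (↧ q * ↧ r) ≡ (↥ q * ↥ r) * ↧ s
*-cross q@(mkℚ _ a _) r@(mkℚ _ b _) s@(mkℚ _ _ _) q*r≡s
  with subst (λ t → ℚᵘ._≃_ (ℚ.toℚᵘ t) (ℚ.toℚᵘ q ℚᵘ.* ℚ.toℚᵘ r)) q*r≡s (ℚ.toℚᵘ-homo-* q r)
... | ℚᵘ.*≡* eq = trans (cong (↥ s *_) (sym (ℤ.pos-* (suc a) (suc b)))) eq

*-/1-cross : ∀ q α β → q ℚ.* (β / 1) ≡ α / 1 → ↥ q * β ≡ α * ↧ q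
*-/1-cross q α β q*β≡α = begin
  ↥ q * β                              ≡⟨ ℤ.*-identityʳ _ ⟨
  (↥ q * β) * + 1                    ≡⟨ cong₂ (λ b a → (↥ q * b) * a) (↥-/1 β) (↧-/1 α) ⟨
  (↥ q * ↥ (β / 1)) * ↧ (α / 1)      ≡⟨ *-cross q (β / 1) (α / 1) q*β≡α ⟨
  ↥ (α / 1) * (↧ q * ↧ (β / 1))      ≡⟨ cong₂ (λ a b → a * (↧ q * b)) (↥-/1 α) (↧-/1 β) ⟩
  α * (↧ q * + 1)                    ≡⟨ cong (α *_) (ℤ.*-identityʳ (↧ q)) ⟩
  α * ↧ q                              ∎
  where open ≡-Reasoning

evalRF-cross : ∀ A B x → evalₚ B x ≢ + 0 →
               ↥ evalRF (A ⁄ B) x * evalₚ B x ≡ evalₚ A x * ↧ evalRF (A ⁄ B) x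
evalRF-cross A B x β≢0 = *-/1-cross (evalRF (A ⁄ B) x) (evalₚ A x) (evalₚ B x) (recip-cancel {evalₚ A x} β≢0)
  where
  recip-cancel : ∀ {α β} → β ≢ + 0 → (α / 1 ℚ.* recipℚ (β / 1)) ℚ.* (β / 1) ≡ α / 1
  recip-cancel {α} {β} β≢0 with (β / 1) ℚ.≟ 0ℚ
  ... | yes β≡0 = contradiction (trans (sym (↥-/1 β)) (ℚ.p≡0⇒↥p≡0 _ β≡0)) β≢0
  ... | no  β≢0 = trans (ℚ.*-assoc (α / 1) _ (β / 1))
                        (trans (cong (α / 1 ℚ.*_) (ℚ.*-inverseˡ (β / 1) {{ℚ.≢-nonZero β≢0}})) (ℚ.*-identityʳ (α / 1)))

module ExactPowers {p : ℕ} (p-prime : Prime p) where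

  open ℕᵈ using (_∣_; _∣?_; divides; *-pres-∣; *-cancelˡ-∣; ∣-trans; ∣-reflexive)

  private
    instance
      p-nonTrivial : ℕ.NonTrivial p
      p-nonTrivial = prime⇒nonTrivial p-prime
      p-nonZero : NonZero p
      p-nonZero = ℕ.nonTrivial⇒nonZero p

  infix 4 p^_∥_
  record p^_∥_ (e : ℕ) (z : ℤ) : Set where
    constructor exactly
    field
      cofactor   : ℕ
      ∣z∣≡       : ∣ z ∣ ≡ p ^ e ℕ.* cofactor
      p∤cofactor : ¬ p ∣ cofactor
  open p^_∥_ public

  p∤* : ∀ {m n} → ¬ p ∣ m → ¬ p ∣ n → ¬ p ∣ m ℕ.* n
  p∤* p∤m p∤n p∣mn with euclidsLemma _ _ p-prime p∣mn
  ... | inj₁ p∣m = p∤m p∣m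
  ... | inj₂ p∣n = p∤n p∣n

  ∥-* : ∀ {e f x y} → p^ e ∥ x → p^ f ∥ y → p^ e ℕ.+ f ∥ x * y
  ∥-* {e} {f} {x} {y} (exactly u ∣x∣≡ p∤u) (exactly v ∣y∣≡ p∤v) = exactly (u ℕ.* v) ∣xy∣≡ (p∤* p∤u p∤v)
    where
    open ≡-Reasoning
    interchange : ∀ a b c d → (a ℕ.* b) ℕ.* (c ℕ.* d) ≡ (a ℕ.* c) ℕ.* (b ℕ.* d)
    interchange = ℕ-Solver.solve-∀
    ∣xy∣≡ : ∣ x * y ∣ ≡ p ^ (e ℕ.+ f) ℕ.* (u ℕ.* v)
    ∣xy∣≡ = begin
      ∣ x * y ∣                              ≡⟨ ℤ.abs-* x y ⟩
      ∣ x ∣ ℕ.* ∣ y ∣                           ≡⟨ cong₂ ℕ._*_ ∣x∣≡ ∣y∣≡ ⟩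
      (p ^ e ℕ.* u) ℕ.* (p ^ f ℕ.* v)           ≡⟨ interchange (p ^ e) u (p ^ f) v ⟩
      (p ^ e ℕ.* p ^ f) ℕ.* (u ℕ.* v)           ≡⟨ cong (ℕ._* (u ℕ.* v)) (ℕ.^-distribˡ-+-* p e f) ⟨
      p ^ (e ℕ.+ f) ℕ.* (u ℕ.* v)               ∎

  p∤⇒≢0 : ∀ {n} → ¬ p ∣ n → n ≢ 0
  p∤⇒≢0 p∤0 refl = p∤0 (divides 0 refl)

  ∥⇒≢0 : ∀ {e z} → p^ e ∥ z → z ≢ + 0
  ∥⇒≢0 {e} (exactly u ∣z∣≡ p∤u) refl with ℕ.m*n≡0⇒m≡0∨n≡0 (p ^ e) (sym ∣z∣≡)
  ... | inj₁ p^e≡0 = ℕ.≢-nonZero⁻¹ (p ^ e) {{ℕ.m^n≢0 p e}} p^e≡0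
  ... | inj₂ u≡0   = p∤⇒≢0 p∤u u≡0

  ordℕ-fuel-∥ : ∀ f n .{{_ : NonZero n}} → n ℕ.≤ f → p^ ordℕ-fuel f p n ∥ + n
  ordℕ-fuel-∥ zero    n n≤0 = contradiction (ℕ.n≤0⇒n≡0 n≤0) (ℕ.≢-nonZero⁻¹ n)
  ordℕ-fuel-∥ (suc f) n n≤f with p ∣? n
  ... | no p∤n = exactly n (sym (ℕ.*-identityˡ n)) p∤n
  ... | yes (divides q n≡q*p) = exactly (cofactor IH) n≡ (p∤cofactor IH)
    where
    instance
      q-nonZero : NonZero q
      q-nonZero = ℕ.≢-nonZero λ { refl → ℕ.≢-nonZero⁻¹ n n≡q*p }
    q<n : q ℕ.< n
    q<n = subst (q ℕ.<_) (sym n≡q*p) (ℕ.m<m*n q p (ℕ.nonTrivial⇒n>1 p))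
    IH : p^ ordℕ-fuel f p q ∥ + q
    IH = ordℕ-fuel-∥ f q (ℕ.≤-pred (ℕ.<-≤-trans q<n n≤f))
    open ≡-Reasoning
    rearrange : ∀ a b c → (a ℕ.* b) ℕ.* c ≡ (c ℕ.* a) ℕ.* b
    rearrange = ℕ-Solver.solve-∀
    n≡ : n ≡ p ^ suc (ordℕ-fuel f p q) ℕ.* cofactor IH
    n≡ = begin
      n                                                   ≡⟨ n≡q*p ⟩
      q ℕ.* p                                             ≡⟨ cong (ℕ._* p) (∣z∣≡ IH) ⟩
      (p ^ ordℕ-fuel f p q ℕ.* cofactor IH) ℕ.* p         ≡⟨ rearrange (p ^ ordℕ-fuel f p q) (cofactor IH) p ⟩
      p ^ suc (ordℕ-fuel f p q) ℕ.* cofactor IH           ∎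

  ordℕ-∥ : ∀ n .{{_ : NonZero n}} → p^ ordℕ p n ∥ + n
  ordℕ-∥ n = ordℕ-fuel-∥ n n ℕ.≤-refl

  ^-monoʳ-∣ : ∀ {m n} → m ℕ.≤ n → p ^ m ∣ p ^ n
  ^-monoʳ-∣ {m} {n} m≤n = divides (p ^ (n ℕ.∸ m)) (begin
    p ^ n                      ≡⟨ cong (p ^_) (ℕ.m∸n+n≡m m≤n) ⟨
    p ^ (n ℕ.∸ m ℕ.+ m)        ≡⟨ ℕ.^-distribˡ-+-* p (n ℕ.∸ m) m ⟩
    p ^ (n ℕ.∸ m) ℕ.* p ^ m    ∎)
    where open ≡-Reasoning

  p^∣p^*⇒≤ : ∀ {a b u} → p ^ a ∣ p ^ b ℕ.* u → ¬ p ∣ u → a ℕ.≤ b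
  p^∣p^*⇒≤ {a} {b} {u} p^a∣p^b*u p∤u with a ℕ.≤? b
  ... | yes a≤b = a≤b
  ... | no  a≰b = contradiction (*-cancelˡ-∣ (p ^ b) {{ℕ.m^n≢0 p b}} p^b*p∣p^b*u) p∤u
    where
    p^b*p∣p^b*u : p ^ b ℕ.* p ∣ p ^ b ℕ.* u
    p^b*p∣p^b*u = ∣-trans (∣-reflexive (ℕ.*-comm (p ^ b) p)) (∣-trans (^-monoʳ-∣ (ℕ.≰⇒> a≰b)) p^a∣p^b*u)

  -- p^(M + ord d) divides p^J·a·d = p^J·n·∣β∣, whose part prime to p is a product of two cofactors
  valuation-≤ : ∀ {n d E M J} {a : ℕ} {β : ℤ} .{{_ : NonZero n}} .{{_ : NonZero d}} →
                p^ E ∥ β → p ^ M ∣ p ^ J ℕ.* a → n ℕ.* ∣ β ∣ ≡ a ℕ.* d →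
                M ℕ.+ ordℕ p d ℕ.≤ J ℕ.+ ordℕ p n ℕ.+ E
  valuation-≤ {n} {d} {E} {M} {J} {a} {β} (exactly u ∣β∣≡ p∤u) p^M∣p^J*a n*∣β∣≡a*d =
    p^∣p^*⇒≤ (subst₂ _∣_ (sym (ℕ.^-distribˡ-+-* p M (ordℕ p d))) product
                         (*-pres-∣ p^M∣p^J*a p^ord[d]∣d))
             (p∤* (p∤cofactor nᵖ) p∤u)
    where
    nᵖ = ordℕ-∥ n
    dᵖ = ordℕ-∥ d
    p^ord[d]∣d : p ^ ordℕ p d ∣ d
    p^ord[d]∣d = divides (cofactor dᵖ) (trans (∣z∣≡ dᵖ) (ℕ.*-comm (p ^ ordℕ p d) (cofactor dᵖ)))
    open ≡-Reasoning
    product : (p ^ J ℕ.* a) ℕ.* d ≡ p ^ (J ℕ.+ ordℕ p n ℕ.+ E) ℕ.* (cofactor nᵖ ℕ.* u)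
    product = begin
      (p ^ J ℕ.* a) ℕ.* d                                          ≡⟨ ℕ.*-assoc (p ^ J) a d ⟩
      p ^ J ℕ.* (a ℕ.* d)                                          ≡⟨ cong (p ^ J ℕ.*_) n*∣β∣≡a*d ⟨
      p ^ J ℕ.* (n ℕ.* ∣ β ∣)                                      ≡⟨ cong₂ (λ x y → p ^ J ℕ.* (x ℕ.* y)) (∣z∣≡ nᵖ) ∣β∣≡ ⟩
      p ^ J ℕ.* ((p ^ ordℕ p n ℕ.* cofactor nᵖ) ℕ.* (p ^ E ℕ.* u))  ≡⟨ regroup (p ^ J) (p ^ ordℕ p n) (cofactor nᵖ) (p ^ E) u ⟩
      ((p ^ J ℕ.* p ^ ordℕ p n) ℕ.* p ^ E) ℕ.* (cofactor nᵖ ℕ.* u)  ≡⟨ cong (ℕ._* (cofactor nᵖ ℕ.* u)) powers ⟩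
      p ^ (J ℕ.+ ordℕ p n ℕ.+ E) ℕ.* (cofactor nᵖ ℕ.* u)           ∎
      where
      regroup : ∀ a b c d e → a ℕ.* ((b ℕ.* c) ℕ.* (d ℕ.* e)) ≡ ((a ℕ.* b) ℕ.* d) ℕ.* (c ℕ.* e)
      regroup = ℕ-Solver.solve-∀
      powers : (p ^ J ℕ.* p ^ ordℕ p n) ℕ.* p ^ E ≡ p ^ (J ℕ.+ ordℕ p n ℕ.+ E)
      powers = sym (trans (ℕ.^-distribˡ-+-* p (J ℕ.+ ordℕ p n) E) (cong (ℕ._* p ^ E) (ℕ.^-distribˡ-+-* p J (ordℕ p n))))

  private
    shuffle-≤ : ∀ {M d J n E} → M ℕ.+ d ℕ.≤ J ℕ.+ n ℕ.+ E → + M - + J - + E ≤ + n - + d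
    shuffle-≤ {M} {d} {J} {n} {E} le = ℤ.0≤i-j⇒j≤i (subst (_≤_ (+ 0)) difference (ℤ.i≤j⇒0≤j-i (ℤ.+≤+ le)))
      where
      regroup : ∀ M d J n E → (J + n + E) - (M + d) ≡ (n - d) - (M - J - E)
      regroup = solve-∀
      difference : + (J ℕ.+ n ℕ.+ E) - + (M ℕ.+ d) ≡ (+ n - + d) - (+ M - + J - + E)
      difference = trans (cong₂ (λ x y → x - y) (trans (ℤ.pos-+ (J ℕ.+ n) E) (cong (_+ + E) (ℤ.pos-+ J n))) (ℤ.pos-+ M d))
                         (regroup (+ M) (+ d) (+ J) (+ n) (+ E))

    ord-ratio-≥ : ∀ n d {α β E M J} .{{_ : NonZero ∣ n ∣}} →
                  p^ E ∥ β → + (p ^ M) ℤᵈ.∣ + (p ^ J) * α → n * β ≡ α * + suc d →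
                  + M - + J - + E ≤ + ordℕ p ∣ n ∣ - + ordℕ p (suc d)
    ord-ratio-≥ n d {α} {β} {E} {M} {J} β∥ p^M∣p^J*α n*β≡α*d =
      shuffle-≤ {M} {ordℕ p (suc d)} {J} {ordℕ p ∣ n ∣} {E} (valuation-≤ {∣ n ∣} {suc d} β∥ unsigned abs-cross)
      where
      unsigned : p ^ M ∣ p ^ J ℕ.* ∣ α ∣
      unsigned = subst (_ ∣_) (ℤ.abs-* (+ (p ^ J)) α) (ℤᵈ.∣⇒∣ᵤ p^M∣p^J*α)
      abs-cross : ∣ n ∣ ℕ.* ∣ β ∣ ≡ ∣ α ∣ ℕ.* suc d
      abs-cross = trans (sym (ℤ.abs-* n β)) (trans (cong ∣_∣ n*β≡α*d) (ℤ.abs-* α (+ suc d)))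

  ordℚ-≥ : ∀ q {α β E M J} → p^ E ∥ β → + (p ^ M) ℤᵈ.∣ + (p ^ J) * α → ↥ q * β ≡ α * ↧ q →
           fin (+ M - + J - + E) ≤∞ ordℚ p q
  ordℚ-≥ (mkℚ (+ zero)     d _) _  _     _     = _ ≤∞∞
  ordℚ-≥ (mkℚ n@(+ suc _)  d _) {E = E} {M} {J} β∥ p^M∣ cross = fin≤fin (ord-ratio-≥ n d {E = E} {M} {J} β∥ p^M∣ cross)
  ordℚ-≥ (mkℚ n@(-[1+ _ ]) d _) {E = E} {M} {J} β∥ p^M∣ cross = fin≤fin (ord-ratio-≥ n d {E = E} {M} {J} β∥ p^M∣ cross)

  ∥⇒∣ : ∀ {e z} → p^ e ∥ z → + (p ^ e) ℤᵈ.∣ z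
  ∥⇒∣ {e} (exactly u ∣z∣≡ _) = ℤᵈ.∣ᵤ⇒∣ (divides u (trans ∣z∣≡ (ℕ.*-comm (p ^ e) u)))

  ∤⇒∥ : ∀ {c} → ¬ + p ℤᵈ.∣ c → p^ 0 ∥ c
  ∤⇒∥ {c} p∤c = exactly ∣ c ∣ (sym (ℕ.*-identityˡ ∣ c ∣)) (λ p∣c → p∤c (ℤᵈ.∣ᵤ⇒∣ p∣c))

  ∣⇒∥ : ∀ {c} → c ≢ + 0 → ∣ c ∣ ℕ.< p ℕ.* p → + p ℤᵈ.∣ c → p^ 1 ∥ c
  ∣⇒∥ {c} c≢0 ∣c∣<p² (ℤᵈ.divides m refl) = exactly ∣ m ∣ ∣c∣≡ p∤m
    where
    ∣c∣≡ : ∣ m * + p ∣ ≡ p ^ 1 ℕ.* ∣ m ∣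
    ∣c∣≡ = trans (ℤ.abs-* m (+ p)) (trans (ℕ.*-comm ∣ m ∣ p) (cong (ℕ._* ∣ m ∣) (sym (ℕ.*-identityʳ p))))
    ∣m∣≢0 : ∣ m ∣ ≢ 0
    ∣m∣≢0 ∣m∣≡0 = c≢0 (cong (_* + p) (ℤ.∣i∣≡0⇒i≡0 {m} ∣m∣≡0))
    p∤m : ¬ p ∣ ∣ m ∣
    p∤m p∣m = ℕ.<⇒≱ ∣c∣<p² (subst (p ℕ.* p ℕ.≤_) (sym (ℤ.abs-* m (+ p)))
                 (ℕ.*-monoˡ-≤ p (ℕᵈ.∣⇒≤ {{ℕ.≢-nonZero ∣m∣≢0}} p∣m)))

  open Floors p

  ⌊/⌋-jump-∥ : ∀ {c} → c ≢ + 0 → ∣ c ∣ ℕ.< p ℕ.* p →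
                 Σ[ v ∈ ℕ ] v ℕ.≤ 1 × p^ v ∥ c × ⌊ c / p ⌋ ≡ ⌊ c - + 1 / p ⌋ + + v
  ⌊/⌋-jump-∥ {c} c≢0 ∣c∣<p² with + p ℤᵈ.∣? c
  ... | yes p∣c = 1 , s≤s z≤n , ∣⇒∥ c≢0 ∣c∣<p² p∣c , ⌊/⌋-step-∣ p∣c
  ... | no  p∤c = 0 , z≤n , ∤⇒∥ p∤c , trans (⌊/⌋-step-∤ p∤c) (sym (ℤ.+-identityʳ _))

module RationalFunctionBounds {p : ℕ} (p-prime : Prime p) (x₀ : ℤ) where

  open ℤᵈ using (_∣_)

  open OrdBounds p x₀
  open ExactPowers p-prime

  record ExactOrdBound (B : Poly) (e : ℕ) : Set where
    constructor exactOrdBound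
    field
      value-exact : p^ e ∥ evalₚ B x₀
      ord-bound   : OrdBound B e 0
  open ExactOrdBound public

  ExactOrdBound-*ₚ : ∀ {A B e f} → ExactOrdBound A e → ExactOrdBound B f → ExactOrdBound (A *ₚ B) (e ℕ.+ f)
  ExactOrdBound-*ₚ {A} {B} bA bB = exactOrdBound
    (subst (p^ _ ∥_) (sym (evalₚ-*ₚ A B x₀)) (∥-* (value-exact bA) (value-exact bB)))
    (OrdBound-*ₚ (ord-bound bA) (ord-bound bB))

  ExactOrdBound-1 : ExactOrdBound (constₚ (+ 1)) 0
  ExactOrdBound-1 = exactOrdBound
    (exactly 1 (cong ∣_∣ (∂-constₚ (+ 1) x₀))
              (λ p∣1 → ℕ.nonTrivial⇒≢1 {{prime⇒nonTrivial p-prime}} (ℕᵈ.∣1⇒≡1 p∣1)))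
    (OrdBound-constₚ ℤᵈ.∣-refl)

  ExactOrdBound-linₚ : ∀ {i v} → v ℕ.≤ 1 → p^ v ∥ evalₚ (linₚ i) x₀ → ExactOrdBound (linₚ i) v
  ExactOrdBound-linₚ {v = v} v≤1 v∥ = exactOrdBound v∥ (OrdBound-linear (∥⇒∣ v∥) (p^v∣p v≤1))
    where
    p^v∣p : v ℕ.≤ 1 → p^ v ∣ p^ 1 * + 1
    p^v∣p z≤n       = ℤᵈ.divides (p^ 1 * + 1) (sym (ℤ.*-identityʳ (p^ 1 * + 1)))
    p^v∣p (s≤s z≤n) = ℤᵈ.∣m⇒∣m*n (+ 1) ℤᵈ.∣-refl

  -- Encodes ord_p F(x₀) ≥ w − e − j. The surplus is needed because the quotient rule squares the
  -- denominator, raising the orders of numerator and denominator by the same amount.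
  record QuotientBound (w e j : ℕ) (F : RatFun) : Set where
    constructor quotientBound
    field
      surplus   : ℕ
      den-exact : ExactOrdBound (den F) (e ℕ.+ surplus)
      num-bound : OrdBound (num F) (w ℕ.+ surplus) j

  QuotientBound-⁄ : ∀ {A B w e} → OrdBound A w 0 → ExactOrdBound B e → QuotientBound w e 0 (A ⁄ B)
  QuotientBound-⁄ {w = w} {e} bA bB =
    quotientBound 0 (subst (ExactOrdBound _) (sym (ℕ.+-identityʳ e)) bB) (subst (λ v → OrdBound _ v 0) (sym (ℕ.+-identityʳ w)) bA)

  QuotientBound-derivRF : ∀ {w e j F} → QuotientBound w e j F → QuotientBound w e (suc j) (derivRF F)
  QuotientBound-derivRF {w} {e} {j} {P ⁄ Q} (quotientBound s bQ bP) = quotientBound (s ℕ.+ (e ℕ.+ s))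
    (subst (ExactOrdBound (Q *ₚ Q)) (ℕ.+-assoc e s (e ℕ.+ s)) (ExactOrdBound-*ₚ bQ bQ))
    (subst (λ v → OrdBound (derivₚ P *ₚ Q +ₚ negₚ (P *ₚ derivₚ Q)) v (suc j)) (ℕ.+-assoc w s (e ℕ.+ s))
      (OrdBound-+ₚ (subst (OrdBound (derivₚ P *ₚ Q) _) (ℕ.+-identityʳ (suc j))
                          (OrdBound-*ₚ (OrdBound-derivₚ bP) (ord-bound bQ)))
                   (OrdBound-·ₚ (- + 1)
                     (subst (OrdBound (P *ₚ derivₚ Q) _) (ℕ.+-comm j 1)
                            (OrdBound-*ₚ bP (OrdBound-derivₚ (ord-bound bQ)))))))

  QuotientBound-derivRF^ : ∀ {w e F} → QuotientBound w e 0 F → ∀ j → QuotientBound w e j (derivRF^ j F)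
  QuotientBound-derivRF^ bF zero    = bF
  QuotientBound-derivRF^ bF (suc j) = QuotientBound-derivRF (QuotientBound-derivRF^ bF j)

  QuotientBound⇒ordℚ : ∀ {w e j F} → QuotientBound w e j F → fin (+ w - + e - + j) ≤∞ ordℚ p (evalRF F x₀)
  QuotientBound⇒ordℚ {w} {e} {j} {A ⁄ B} (quotientBound s bB bA) =
    subst (λ z → fin z ≤∞ ordℚ p (evalRF (A ⁄ B) x₀)) exponent
      (ordℚ-≥ (evalRF (A ⁄ B) x₀) {E = e ℕ.+ s} {w ℕ.+ s} {j} (value-exact bB)
              (divides-∂ bA 0)
              (evalRF-cross A B x₀ (∥⇒≢0 (value-exact bB))))
    where
    cancel : ∀ w s j e → (w + s) - j - (e + s) ≡ w - e - j
    cancel = solve-∀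
    exponent : + (w ℕ.+ s) - + j - + (e ℕ.+ s) ≡ + w - + e - + j
    exponent = trans (cong₂ (λ a b → a - + j - b) (ℤ.pos-+ w s) (ℤ.pos-+ e s)) (cancel (+ w) (+ s) (+ j) (+ e))


skipFactor : ℤ → ℤ → List Poly → List Poly
skipFactor k i acc with i ℤ.≟ k
... | yes _ = acc
... | no  _ = linₚ i ∷ acc

skipFactor-≡ : ∀ {k i} acc → i ≡ k → skipFactor k i acc ≡ acc
skipFactor-≡ {k} {i} acc i≡k with i ℤ.≟ k
... | yes _   = refl
... | no  i≢k = contradiction i≡k i≢k

skipFactor-≢ : ∀ {k i} acc → i ≢ k → skipFactor k i acc ≡ linₚ i ∷ acc
skipFactor-≢ {k} {i} acc i≢k with i ℤ.≟ k
... | yes i≡k = contradiction i≡k i≢k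
... | no  _   = refl

-- The step function of the fold in denFactors is where-bound in Defs; stepOf names it by unification.
denFactors-step : ℤ → ℤ → ℤ → ℤ → List Poly → List Poly
denFactors-step a b k = stepOf (range a ∣ b - a ∣) refl
  where
  stepOf : ∀ {f : ℤ → List Poly → List Poly} is → denFactors a b k ≡ foldr f [] is → ℤ → List Poly → List Poly
  stepOf {f} _ _ = f

denFactors-step≗skipFactor : ∀ a b k i acc → denFactors-step a b k i acc ≡ skipFactor k i acc
denFactors-step≗skipFactor a b k i acc with i ℤ.≟ k
... | yes _ = refl
... | no  _ = refl

factors : ℤ → ℤ → ℕ → List Poly
factors a k zero    = []
factors a k (suc n) = skipFactor k (a + + n) (factors a k n)

foldr-range≡factors : ∀ a k n → foldr (skipFactor k) [] (range a n) ≡ factors a k n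
foldr-range≡factors a k zero    = refl
foldr-range≡factors a k (suc n) = cong (skipFactor k (a + + n)) (foldr-range≡factors a k n)

denFactors≡factors : ∀ a b k → denFactors a b k ≡ factors a k ∣ b - a ∣
denFactors≡factors a b k = trans (foldr-cong (denFactors-step≗skipFactor a b k) refl (range a ∣ b - a ∣))
                                 (foldr-range≡factors a k ∣ b - a ∣)

module DenominatorBound {p : ℕ} (p-prime : Prime p) (a k : ℤ) where

  open ℤᵈ using (_∣_)

  private
    instance
      p-nonZero : NonZero p
      p-nonZero = prime⇒nonZero p-prime

  open ExactPowers p-prime
  open OrdBounds p (- k)
  open RationalFunctionBounds p-prime (- k)
  open Floors p

  record DenBound (n : ℕ) : Set where
    constructor denBound
    field
      e         : ℕ
      exact     : ExactOrdBound (prodₚ (factors a k n)) e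
      count-in  : a ≤ k → k < a + + n → + e + + 1 ≡ multiples (a - k) n
      count-out : k < a ⊎ a + + n ≤ k → + e ≡ multiples (a - k) n

  private
    a-k+n≡a+n-k : ∀ n → (a - k) + + n ≡ a + + n - k
    a-k+n≡a+n-k n = regroup a k (+ n)
      where
      regroup : ∀ a k n → (a - k) + n ≡ a + n - k
      regroup = solve-∀

    a+n<a+suc[n] : ∀ n → a + + n < a + + suc n
    a+n<a+suc[n] n = ℤ.+-monoʳ-< a (ℤ.+<+ (ℕ.n<1+n n))

    evalₚ-linₚ : ∀ i → evalₚ (linₚ i) (- k) ≡ i - k
    evalₚ-linₚ i = horner i k
      where
      horner : ∀ i k → i + - k * (+ 1 + - k * + 0) ≡ i - k
      horner = solve-∀

  DenBound-skip : ∀ {n} → a + + n ≡ k → DenBound n → DenBound (suc n)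
  DenBound-skip {n} a+n≡k (denBound e exact count-in count-out) =
    denBound e (subst (λ fs → ExactOrdBound (prodₚ fs) e) (sym (skipFactor-≡ (factors a k n) a+n≡k)) exact)
      (λ _ _ → trans (cong (_+ + 1) (count-out (inj₂ (ℤ.≤-reflexive a+n≡k)))) (sym (multiples-suc (a - k) n jump)))
      λ { (inj₁ k<a)     → contradiction k<a (ℤ.≤⇒≯ a≤k)
        ; (inj₂ a+sn≤k) → contradiction (subst (_< a + + suc n) a+n≡k (a+n<a+suc[n] n)) (ℤ.≤⇒≯ a+sn≤k) }
    where
    a≤k : a ≤ k
    a≤k = subst (a ≤_) a+n≡k (ℤ.i≤i+j a (+ n))
    a-k+n≡0 : (a - k) + + n ≡ + 0
    a-k+n≡0 = trans (a-k+n≡a+n-k n) (trans (cong (_- k) a+n≡k) (ℤ.+-inverseʳ k))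
    jump : ⌊ (a - k) + + n / p ⌋ ≡ ⌊ (a - k) + + n - + 1 / p ⌋ + + 1
    jump = ⌊/⌋-step-∣ (subst (+ p ∣_) (sym a-k+n≡0) (ℤᵈ.divides (+ 0) refl))

  DenBound-keep : ∀ {n v} → a + + n ≢ k → v ℕ.≤ 1 → p^ v ∥ (a - k) + + n →
                  ⌊ (a - k) + + n / p ⌋ ≡ ⌊ (a - k) + + n - + 1 / p ⌋ + + v → DenBound n → DenBound (suc n)
  DenBound-keep {n} {v} a+n≢k v≤1 v∥ jump (denBound e exact count-in count-out) =
    denBound (v ℕ.+ e) (subst (λ fs → ExactOrdBound (prodₚ fs) (v ℕ.+ e)) (sym (skipFactor-≢ (factors a k n) a+n≢k)) exact′)
      (λ a≤k k<a+sn → trans (+1-shift (count-in a≤k (k<a+n k<a+sn))) (sym (multiples-suc (a - k) n jump)))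
      λ { (inj₁ k<a)     → trans (shift (count-out (inj₁ k<a))) (sym (multiples-suc (a - k) n jump))
        ; (inj₂ a+sn≤k) → trans (shift (count-out (inj₂ (ℤ.≤-trans (ℤ.<⇒≤ (a+n<a+suc[n] n)) a+sn≤k))))
                                 (sym (multiples-suc (a - k) n jump)) }
    where
    exact′ : ExactOrdBound (linₚ (a + + n) *ₚ prodₚ (factors a k n)) (v ℕ.+ e)
    exact′ = ExactOrdBound-*ₚ (ExactOrdBound-linₚ {a + + n} v≤1 (subst (p^ v ∥_) value v∥)) exact
      where
      value : (a - k) + + n ≡ evalₚ (linₚ (a + + n)) (- k)
      value = trans (a-k+n≡a+n-k n) (sym (evalₚ-linₚ (a + + n)))
    k<a+n : k < a + + suc n → k < a + + n
    k<a+n k<a+sn = ℤ.≤∧≢⇒< (subst (k ≤_) (pred[a+suc[n]] a (+ n)) (ℤ.i<j⇒i≤pred[j] k<a+sn))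
                           (λ k≡a+n → a+n≢k (sym k≡a+n))
      where
      pred[a+suc[n]] : ∀ a n → - + 1 + (a + (+ 1 + n)) ≡ a + n
      pred[a+suc[n]] = solve-∀
    shift : ∀ {m} → + e ≡ m → + (v ℕ.+ e) ≡ m + + v
    shift refl = trans (ℤ.pos-+ v e) (ℤ.+-comm (+ v) (+ e))
    +1-shift : ∀ {m} → + e + + 1 ≡ m → + (v ℕ.+ e) + + 1 ≡ m + + v
    +1-shift refl = trans (cong (_+ + 1) (ℤ.pos-+ v e)) (swap (+ v) (+ e))
      where
      swap : ∀ v e → v + e + + 1 ≡ e + + 1 + v
      swap = solve-∀

  den-bound : ∀ n → (∀ i → a ≤ i → i < a + + n → ∣ i - k ∣ ℕ.< p ℕ.* p) → DenBound n
  den-bound zero    _     = denBound 0 ExactOrdBound-1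
    (λ a≤k k<a+0 → contradiction (subst (k <_) (ℤ.+-identityʳ a) k<a+0) (ℤ.≤⇒≯ a≤k))
    (λ _ → sym (multiples-zero (a - k)))
  den-bound (suc n) close with a + + n ℤ.≟ k
  ... | yes a+n≡k = DenBound-skip a+n≡k IH
    where IH = den-bound n (λ i a≤i i<a+n → close i a≤i (ℤ.<-trans i<a+n (a+n<a+suc[n] n)))
  ... | no  a+n≢k = let v , v≤1 , v∥ , jump = ⌊/⌋-jump-∥ a-k+n≢0 ∣a-k+n∣<p² in DenBound-keep a+n≢k v≤1 v∥ jump IH
    where
    IH = den-bound n (λ i a≤i i<a+n → close i a≤i (ℤ.<-trans i<a+n (a+n<a+suc[n] n)))
    a-k+n≢0 : (a - k) + + n ≢ + 0
    a-k+n≢0 a-k+n≡0 = a+n≢k (ℤ.i-j≡0⇒i≡j (a + + n) k (trans (sym (a-k+n≡a+n-k n)) a-k+n≡0))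
    ∣a-k+n∣<p² : ∣ (a - k) + + n ∣ ℕ.< p ℕ.* p
    ∣a-k+n∣<p² = subst (λ x → ∣ x ∣ ℕ.< p ℕ.* p) (sym (a-k+n≡a+n-k n)) (close (a + + n) (ℤ.i≤i+j a (+ n)) (a+n<a+suc[n] n))

bounded⇒∣∣< : ∀ {x B N} → x ≤ B → - B ≤ x → B < + N → ∣ x ∣ ℕ.< N
bounded⇒∣∣< {+ n}      x≤B _    B<N = ℤ.drop‿+<+ (ℤ.≤-<-trans x≤B B<N)
bounded⇒∣∣< { -[1+ n ]} {B} _ -B≤x B<N =
  ℤ.drop‿+<+ (ℤ.≤-<-trans (subst (+ suc n ≤_) (ℤ.neg-involutive B) (ℤ.neg-mono-≤ -B≤x)) B<N)

∣i-k∣<-window : ∀ {lo hi i k N} → lo ≤ i → i < hi → lo ≤ k → k < hi → hi - lo - + 1 < + N → ∣ i - k ∣ ℕ.< N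
∣i-k∣<-window {lo} {hi} {i} {k} lo≤i i<hi lo≤k k<hi window<N =
  bounded⇒∣∣< (difference-≤ lo≤i i<hi lo≤k)
                  (subst (- (hi - lo - + 1) ≤_) (negate k i) (ℤ.neg-mono-≤ (difference-≤ lo≤k k<hi lo≤i)))
                  window<N
  where
  rearrange : ∀ hi lo → - + 1 + hi + - lo ≡ hi - lo - + 1
  rearrange = solve-∀
  negate : ∀ k i → - (k - i) ≡ i - k
  negate = solve-∀
  difference-≤ : ∀ {x y} → lo ≤ x → x < hi → lo ≤ y → x - y ≤ hi - lo - + 1
  difference-≤ {x} {y} _ x<hi lo≤y =
    subst (x - y ≤_) (rearrange hi lo) (ℤ.+-mono-≤ (ℤ.i<j⇒i≤pred[j] x<hi) (ℤ.neg-mono-≤ lo≤y))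

module RtimesLinBound {p : ℕ} (p-prime : Prime p) {a b k : ℤ} (a<b : a < b)
                      (close : ∀ i → a ≤ i → i < b → ∣ i - k ∣ ℕ.< p ℕ.* p) where

  open ℤᵈ using (_∣_)

  private
    instance
      p-nonZero : NonZero p
      p-nonZero = prime⇒nonZero p-prime

  open OrdBounds p (- k)
  open RationalFunctionBounds p-prime (- k)
  open Floors p
  open DenominatorBound p-prime a k

  n N : ℕ
  n = ∣ b - a ∣
  N = n ℕ.∸ 1

  private
    b-a≡n : b - a ≡ + n
    b-a≡n = sym (ℤ.0≤i⇒+∣i∣≡i (ℤ.i≤j⇒0≤j-i (ℤ.<⇒≤ a<b)))

    a+n≡b : a + + n ≡ b
    a+n≡b = trans (cong (_+_ a) (sym b-a≡n)) (cancel a b)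
      where
      cancel : ∀ a b → a + (b - a) ≡ b
      cancel = solve-∀

    b-a-1≡N : b - a - + 1 ≡ + N
    b-a-1≡N = trans (cong (_- + 1) b-a≡n) (trans (ℤ.m-n≡m⊖n n 1) (ℤ.⊖-≥ (ℕ.n≢0⇒n>0 n≢0)))
      where
      n≢0 : n ≢ 0
      n≢0 n≡0 = ℤ.<-irrefl (sym (ℤ.i-j≡0⇒i≡j b a (trans b-a≡n (cong +_ n≡0)))) a<b

  open DenBound (den-bound n (λ i a≤i i<a+n → close i a≤i (subst (i <_) a+n≡b i<a+n)))

  OrdBound-·ₚ-linₚ : ∀ {c w} → p^ w ∣ c → OrdBound (c ·ₚ linₚ k) (suc w) 0
  OrdBound-·ₚ-linₚ {c} {w} p^w∣c = OrdBound-linear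
    (subst (p^ suc w ∣_) (sym (vanishes c k)) (ℤᵈ.divides (+ 0) refl))
    (subst (_∣ p^ 1 * (c * + 1)) (sym (p^-+ 1 w)) (*-pres-∣ᶻ {p^ 1} {p^ w} ℤᵈ.∣-refl (ℤᵈ.∣m⇒∣m*n (+ 1) p^w∣c)))
    where
    vanishes : ∀ c k → c * k + - k * (c * + 1 + - k * + 0) ≡ + 0
    vanishes = solve-∀

  p^[N/p]∣N! : p^ (N ℕ./ p) ∣ + (N !)
  p^[N/p]∣N! = ℤᵈ.∣ᵤ⇒∣ (p^[n/p]∣n! p N)

  private
    FN Fka F1 : ℤ
    FN  = ⌊ b - a - + 1 / p ⌋
    Fka = ⌊ k - a / p ⌋
    F1  = ⌊ b - + 1 - k / p ⌋

    FN≡ : FN ≡ + (N ℕ./ p)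
    FN≡ = trans (cong ⌊_/ p ⌋ b-a-1≡N) (⌊/⌋≡/ℕ (+ N) p)

    multiples≡ : multiples (a - k) n ≡ F1 + Fka + + 1
    multiples≡ = begin
      ⌊ (a - k) + + n - + 1 / p ⌋ - ⌊ (a - k) - + 1 / p ⌋
        ≡⟨ cong₂ (λ x y → ⌊ x / p ⌋ - ⌊ y / p ⌋)
                 (trans (regroupᵘ a k (+ n)) (cong (λ x → x - + 1 - k) a+n≡b)) (regroupˡ a k) ⟩
      F1 - ⌊ - (k - a) - + 1 / p ⌋
        ≡⟨ cong (_-_ F1) (⌊/⌋-neg (k - a)) ⟩
      F1 - (- Fka - + 1)
        ≡⟨ simplify F1 Fka ⟩
      F1 + Fka + + 1 ∎
      where
      open ≡-Reasoning
      regroupᵘ : ∀ a k n → (a - k) + n - + 1 ≡ a + n - + 1 - k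
      regroupᵘ = solve-∀
      regroupˡ : ∀ a k → (a - k) - + 1 ≡ - (k - a) - + 1
      regroupˡ = solve-∀
      simplify : ∀ x y → x - (- y - + 1) ≡ x + y + + 1
      simplify = solve-∀

    exponent-in : + e + + 1 ≡ multiples (a - k) n → + (N ℕ./ p) - + e ≡ FN - Fka - F1
    exponent-in count = begin
      + (N ℕ./ p) - + e                  ≡⟨ cong₂ _-_ (sym FN≡) (add-sub (+ e)) ⟩
      FN - (+ e + + 1 - + 1)             ≡⟨ cong (λ x → FN - (x - + 1)) (trans count multiples≡) ⟩
      FN - (F1 + Fka + + 1 - + 1)        ≡⟨ simplify FN F1 Fka ⟩
      FN - Fka - F1                      ∎
      where
      open ≡-Reasoning
      add-sub : ∀ x → x ≡ x + + 1 - + 1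
      add-sub = solve-∀
      simplify : ∀ x y z → x - (y + z + + 1 - + 1) ≡ x - z - y
      simplify = solve-∀

    exponent-out : + e ≡ multiples (a - k) n → + suc (N ℕ./ p) - + e ≡ FN - Fka - F1
    exponent-out count = begin
      + 1 + + (N ℕ./ p) - + e            ≡⟨ cong₂ (λ x y → + 1 + x - y) (sym FN≡) (trans count multiples≡) ⟩
      + 1 + FN - (F1 + Fka + + 1)        ≡⟨ simplify FN F1 Fka ⟩
      FN - Fka - F1                      ∎
      where
      open ≡-Reasoning
      simplify : ∀ x y z → + 1 + x - (y + z + + 1) ≡ x - z - y
      simplify = solve-∀

    den-exact : ExactOrdBound (prodₚ (denFactors a b k)) e
    den-exact = subst (λ fs → ExactOrdBound (prodₚ fs) e) (sym (denFactors≡factors a b k)) exact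

  RtimesLin-QuotientBound : Σ[ w ∈ ℕ ] Σ[ e ∈ ℕ ] QuotientBound w e 0 (RtimesLin a b k) × + w - + e ≡ FN - Fka - F1
  RtimesLin-QuotientBound with a ℤ.≤? k | k ℤ.<? b
  ... | yes a≤k | yes k<b = N ℕ./ p , e , QuotientBound-⁄ (OrdBound-constₚ p^[N/p]∣N!) den-exact ,
                            exponent-in (count-in a≤k (subst (k <_) (sym a+n≡b) k<b))
  ... | yes _   | no  k≮b = suc (N ℕ./ p) , e , QuotientBound-⁄ (OrdBound-·ₚ-linₚ p^[N/p]∣N!) den-exact ,
                            exponent-out (count-out (inj₂ (subst (_≤ k) (sym a+n≡b) (ℤ.≮⇒≥ k≮b))))
  ... | no  a≰k | _       = suc (N ℕ./ p) , e , QuotientBound-⁄ (OrdBound-·ₚ-linₚ p^[N/p]∣N!) den-exact ,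
                            exponent-out (count-out (inj₁ (ℤ.≰⇒> a≰k)))

lemma18 : (a b a₀ b₀ : ℤ) → a₀ ≤ a → a < b → b ≤ b₀ →
          (k : ℤ) → a₀ ≤ k → k < b₀ →
          (p : ℕ) → Prime p → b₀ - a₀ - + 1 < + (p ℕ.* p) →
          (j : ℕ) →
          fin (- (+ j) ℤ.+ ⌊ b - a - + 1 / p ⌋ - ⌊ k - a / p ⌋ - ⌊ b - + 1 - k / p ⌋)
            ≤∞ ordℚ p (evalRF (derivRF^ j (RtimesLin a b k)) (- k))
lemma18 a b a₀ b₀ a₀≤a a<b b≤b₀ k a₀≤k k<b₀ p p-prime window<p² j =
  let w , e , bound , w-e≡ = RtimesLin-QuotientBound a<b close in
  subst (λ z → fin z ≤∞ ordℚ p (evalRF (derivRF^ j (RtimesLin a b k)) (- k)))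
          (trans (cong (_- + j) w-e≡) (reorder _ _ _ (+ j)))
          (QuotientBound⇒ordℚ (QuotientBound-derivRF^ bound j))
  where
  open RtimesLinBound p-prime using (RtimesLin-QuotientBound)
  open RationalFunctionBounds p-prime (- k) using (QuotientBound⇒ordℚ; QuotientBound-derivRF^)
  reorder : ∀ x y z j → x - y - z - j ≡ - j + x - y - z
  reorder = solve-∀
  close : ∀ i → a ≤ i → i < b → ∣ i - k ∣ ℕ.< p ℕ.* p
  close i a≤i i<b = ∣i-k∣<-window (ℤ.≤-trans a₀≤a a≤i) (ℤ.<-≤-trans i<b b≤b₀) a₀≤k k<b₀ window<p²
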